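{- The T rule is admissible in $\mathbf{HMR}$: every hypersequent that has a derivation in $\mathbf{HMR}$ has a derivation in $\mathbf{HMR}$ that contains no instance of the T rule.
   Context: Terms. Fix a countable set of variables $x,y,\dots$. Terms (in negation normal form) are generated by $A ::= x \mid \overline{x} \mid 0 \mid 1 \mid \overline{1} \mid A+A \mid rA \mid A\sqcup A \mid A\sqcap A \mid \Diamond A$ with $r\in\mathbb{R}_{>0}$. Negation: $\overline{x}$ for $x$, $\overline{\overline{x}}=x$, $\overline{0}=0$, $\overline 1$ for $1$, $\overline{\overline{1}}=1$, $\overline{A+B}=\overline A+\overline B$, $\overline{rA}=r\overline A$, $\overline{A\sqcup B}=\overline A\sqcap\overline B$, $\overline{A\sqcap B}=\overline A\sqcup\overline B$, $\overline{\Diamond A}=\Diamond\overline A$. A weighted term is $r.A$ ($r>0$); a sequent $\vdash\Gamma$ has $\Gamma$ a finite (possibly empty) multiset of weighted terms; a hypersequent is a nonempty finite multiset of sequents $\vdash\Gamma_1\mid\cdots\mid\vdash\Gamma_n$; $G\mid\vdash\Gamma$ adds a sequent. For a finite (possibly empty) sequence $\vec r=(r_1,\dots,r_n)$ of positive reals, $\vec r.A$ is the multiset $r_1.A,\dots,r_n.A$, $\sum\vec r=r_1+\dots+r_n$, $s\vec r=(sr_1,\dots,sr_n)$; $s.\Gamma$ multiplies all weights by $s>0$; if $\Gamma=r_1.A_1,\dots,r_n.A_n$ then $\Diamond\Gamma=r_1.\Diamond A_1,\dots,r_n.\Diamond A_n$. The calculus $\mathbf{HMR}$ has the rules: INIT: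 $\vdash$ with no premises. W: from $G$ infer $G\mid\vdash\Gamma$. C: from $G\mid\vdash\Gamma\mid\vdash\Gamma$ infer $G\mid\vdash\Gamma$. S: from $G\mid\vdash\Gamma_1,\Gamma_2$ infer $G\mid\vdash\Gamma_1\mid\vdash\Gamma_2$. M: from $G\mid\vdash\Gamma_1$ and $G\mid\vdash\Gamma_2$ infer $G\mid\vdash\Gamma_1,\Gamma_2$. T: for $r>0$, from $G\mid\vdash r.\Gamma$ infer $G\mid\vdash\Gamma$. ID: if $\sum\vec r=\sum\vec s$, from $G\mid\vdash\Gamma$ infer $G\mid\vdash\Gamma,\vec r.x,\vec s.\overline{x}$ ($x$ a variable). 0: from $G\mid\vdash\Gamma$ infer $G\mid\vdash\Gamma,\vec r.0$. $+$: from $G\mid\vdash\Gamma,\vec r.A,\vec r.B$ infer $G\mid\vdash\Gamma,\vec r.(A+B)$. $\times$: from $G\mid\vdash\Gamma,(s\vec r).A$ infer $G\mid\vdash\Gamma,\vec r.(sA)$. $\sqcup$: from $G\mid\vdash\Gamma,\vec r.A\mid\vdash\Gamma,\vec r.B$ infer $G\mid\vdash\Gamma,\vec r.(A\sqcup B)$. $\sqcap$: from $G\mid\vdash\Gamma,\vec r.A$ and $G\mid\vdash\Gamma,\vec r.B$ infer $G\mid\vdash\Gamma,\vec r.(A\sqcap B)$. CAN: if $\sum\vec r=\sum\vec s$, from $G\mid\vdash\Gamma,\vec s.A,\vec r.\overline A$ infer $G\mid\vdash\Gamma$. 1: if $\sum\vec r\geq\sum\vec s$, from $G\mid\vdash\Gamma$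 infer $G\mid\vdash\Gamma,\vec r.1,\vec s.\overline{1}$. $\Diamond$: if $\sum\vec r\geq\sum\vec s$, from the single-sequent hypersequent $\vdash\Gamma,\vec r.1,\vec s.\overline 1$ infer the single-sequent hypersequent $\vdash\Diamond\Gamma,\vec r.1,\vec s.\overline 1$. A derivation is a finite tree of rule instances whose leaves are INIT. -}

module Defs where

open import Data.Nat using (ℕ)
open import Data.Bool using (Bool; true; false)
open import Data.Product using (∃; _×_; _,_)
open import Data.Sum using (_⊎_)
open import Data.List using (List; []; _∷_; _++_; map; foldr)
open import Data.List.Relation.Binary.Permutation.Propositional using (_↭_)
open import Data.List.Relation.Binary.Pointwise using (Pointwise)
open import Relation.Binary.PropositionalEquality using (_≡_)
open import Relation.Nullary using (¬_)
import Algebra.Structures as AS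
import Relation.Binary.Structures as RS

-- The real numbers, axiomatised as a complete ordered field
-- (with propositional equality as the field equality).  Every model is
-- (isomorphic to) ℝ.

record RealField : Set₁ where
  infixl 6 _+_
  infixl 7 _*_
  infix 4 _<_ _≤_
  field
    Carrier : Set
    _+_ _*_ : Carrier → Carrier → Carrier
    -_      : Carrier → Carrier
    0# 1#   : Carrier
    _<_     : Carrier → Carrier → Set
    isCommutativeRing : AS.IsCommutativeRing _≡_ _+_ _*_ -_ 0# 1#
    *-inverse : ∀ x → ¬ (x ≡ 0#) → ∃ λ y → x * y ≡ 1#
    isStrictTotalOrder : RS.IsStrictTotalOrder _≡_ _<_
    +-mono-< : ∀ {x y} z → x < y → x + z < y + z
    *-pos    : ∀ {x y} → 0# < x → 0# < y → 0# < x * y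
    0<1      : 0# < 1#

  _≤_ : Carrier → Carrier → Set
  x ≤ y = (x < y) ⊎ (x ≡ y)

  field
    completeness : (P : Carrier → Set) → ∃ P →
                   (∃ λ b → ∀ x → P x → x ≤ b) →
                   ∃ λ s → (∀ x → P x → x ≤ s) ×
                           (∀ b → (∀ x → P x → x ≤ b) → s ≤ b)

module HMR (ℝ : RealField) where
  open RealField ℝ

  -- strictly positive reals; positivity proof is irrelevant, so two
  -- positive reals are equal iff their values are.
  record ℝ>0 : Set where
    constructor pos
    field
      val   : Carrier
      .is>0 : 0# < val
  open ℝ>0 public

  _·⁺_ : ℝ>0 → ℝ>0 → ℝ>0
  pos r p ·⁺ pos s q = pos (r * s) (*-pos p q)

  -- Terms in negation normal form; variables are natural numbers.
  infixl 6 _⊕_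
  data Term : Set where
    var   : ℕ → Term
    covar : ℕ → Term
    𝟘     : Term
    𝟙     : Term
    𝟙̄     : Term
    _⊕_   : Term → Term → Term
    _⊙_   : ℝ>0 → Term → Term
    _⊔_   : Term → Term → Term
    _⊓_   : Term → Term → Term
    ◇     : Term → Term

  neg : Term → Term
  neg (var x)   = covar x
  neg (covar x) = var x
  neg 𝟘         = 𝟘
  neg 𝟙         = 𝟙̄
  neg 𝟙̄         = 𝟙
  neg (A ⊕ B)   = neg A ⊕ neg B
  neg (r ⊙ A)   = r ⊙ neg A
  neg (A ⊔ B)   = neg A ⊓ neg B
  neg (A ⊓ B)   = neg A ⊔ neg B
  neg (◇ A)     = ◇ (neg A)

  WTerm : Set
  WTerm = ℝ>0 × Term

  -- sequents ⊢ Γ : finite multisets of weighted terms (lists up to ↭)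
  Sequent : Set
  Sequent = List WTerm

  -- hypersequents: finite multisets of sequents (lists up to
  -- permutation of the list and of each sequent)
  HSeq : Set
  HSeq = List Sequent

  _≈S_ : Sequent → Sequent → Set
  Γ ≈S Δ = Γ ↭ Δ

  _≈H_ : HSeq → HSeq → Set
  G ≈H H = ∃ λ G' → (G ↭ G') × Pointwise _≈S_ G' H

  _∙_ : List ℝ>0 → Term → Sequent
  rs ∙ A = map (λ r → r , A) rs

  Σ⃗ : List ℝ>0 → Carrier
  Σ⃗ = foldr (λ r acc → val r + acc) 0#

  scale : ℝ>0 → Sequent → Sequent
  scale s = map (λ { (r , A) → (s ·⁺ r) , A })

  ◇S : Sequent → Sequent
  ◇S = map (λ { (r , A) → r , ◇ A })

  -- G | ⊢ Γ is represented as Γ ∷ G.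
  -- The index `withT` says whether the T rule may be used: a
  -- derivation in `Deriv false` is exactly an HMR derivation containing
  -- no instance of T.  The constructor `exch` makes explicit that
  -- hypersequents/sequents are multisets (it is not an inference rule).
  data Deriv (withT : Bool) : HSeq → Set where
    INIT : Deriv withT ([] ∷ [])
    exch : ∀ {G H} → G ≈H H → Deriv withT G → Deriv withT H
    W    : ∀ {G Γ} → Deriv withT G → Deriv withT (Γ ∷ G)
    C    : ∀ {G Γ} → Deriv withT (Γ ∷ Γ ∷ G) → Deriv withT (Γ ∷ G)
    S    : ∀ {G Γ₁ Γ₂} → Deriv withT ((Γ₁ ++ Γ₂) ∷ G) →
           Deriv withT (Γ₁ ∷ Γ₂ ∷ G)
    M    : ∀ {G Γ₁ Γ₂} → Deriv withT (Γ₁ ∷ G) → Deriv withT (Γ₂ ∷ G) →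
           Deriv withT ((Γ₁ ++ Γ₂) ∷ G)
    T    : ∀ {G Γ} → withT ≡ true → (r : ℝ>0) →
           Deriv withT (scale r Γ ∷ G) → Deriv withT (Γ ∷ G)
    ID   : ∀ {G Γ} (x : ℕ) (rs ss : List ℝ>0) → Σ⃗ rs ≡ Σ⃗ ss →
           Deriv withT (Γ ∷ G) →
           Deriv withT ((Γ ++ rs ∙ var x ++ ss ∙ covar x) ∷ G)
    Z    : ∀ {G Γ} (rs : List ℝ>0) → Deriv withT (Γ ∷ G) →
           Deriv withT ((Γ ++ rs ∙ 𝟘) ∷ G)
    PLUS : ∀ {G Γ A B} (rs : List ℝ>0) →
           Deriv withT ((Γ ++ rs ∙ A ++ rs ∙ B) ∷ G) →
           Deriv withT ((Γ ++ rs ∙ (A ⊕ B)) ∷ G)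
    TIMES : ∀ {G Γ A} (s : ℝ>0) (rs : List ℝ>0) →
           Deriv withT ((Γ ++ map (s ·⁺_) rs ∙ A) ∷ G) →
           Deriv withT ((Γ ++ rs ∙ (s ⊙ A)) ∷ G)
    SUP  : ∀ {G Γ A B} (rs : List ℝ>0) →
           Deriv withT ((Γ ++ rs ∙ A) ∷ (Γ ++ rs ∙ B) ∷ G) →
           Deriv withT ((Γ ++ rs ∙ (A ⊔ B)) ∷ G)
    INF  : ∀ {G Γ A B} (rs : List ℝ>0) →
           Deriv withT ((Γ ++ rs ∙ A) ∷ G) →
           Deriv withT ((Γ ++ rs ∙ B) ∷ G) →
           Deriv withT ((Γ ++ rs ∙ (A ⊓ B)) ∷ G)
    CAN  : ∀ {G Γ} (A : Term) (rs ss : List ℝ>0) → Σ⃗ rs ≡ Σ⃗ ss →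
           Deriv withT ((Γ ++ ss ∙ A ++ rs ∙ neg A) ∷ G) →
           Deriv withT (Γ ∷ G)
    ONE  : ∀ {G Γ} (rs ss : List ℝ>0) → Σ⃗ ss ≤ Σ⃗ rs →
           Deriv withT (Γ ∷ G) →
           Deriv withT ((Γ ++ rs ∙ 𝟙 ++ ss ∙ 𝟙̄) ∷ G)
    DIA  : ∀ {Γ} (rs ss : List ℝ>0) → Σ⃗ ss ≤ Σ⃗ rs →
           Deriv withT ((Γ ++ rs ∙ 𝟙 ++ ss ∙ 𝟙̄) ∷ []) →
           Deriv withT ((◇S Γ ++ rs ∙ 𝟙 ++ ss ∙ 𝟙̄) ∷ [])

  Derivable : HSeq → Set
  Derivable = Deriv true

  DerivableWithoutT : HSeq → Set
  DerivableWithoutT = Deriv false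

-- T-free derivability is closed under rescaling each sequent of a hypersequent by
-- its own positive factor; an instance of T with factor r is then the rescaling of
-- its (T-free) premise by r⁻¹ on the active sequent.  The rescaling is proved by
-- induction on the derivation: every rule commutes with uniform scaling except S,
-- whose two conclusions are to be scaled by independent factors a and b.  There one
-- rescales the premise by ab/(a+b), packs Γ₁ and Γ₂ into single terms X and Y, and
-- uses CAN to derive c₁.(aX ⊔ bY), c₂.(aX ⊔ bY) with c₁ + c₂ = 1; inverting ⊔ and
-- unpacking yields ⊢ aΓ₁ | ⊢ bΓ₂.

module Submission where

open import Defs
open import Data.Bool using (Bool; true; false)
open import Data.Empty using (⊥-elim)
open import Data.Product using (∃; _×_; _,_; proj₁; proj₂)
open import Data.Sum using (inj₁; inj₂)
open import Data.List using (List; []; _∷_; _++_; map; [_])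
open import Data.List.Properties using (map-++; map-∘; map-cong; ++-identityʳ)
open import Data.List.Relation.Binary.Permutation.Propositional
  using (_↭_; prep; swap) renaming (refl to ↭-refl; trans to ↭-trans)
import Data.List.Relation.Binary.Permutation.Propositional.Properties as ↭
open import Data.List.Relation.Binary.Pointwise as Pointwise
  using (Pointwise; []; _∷_)
open import Relation.Binary.PropositionalEquality
  using (_≡_; refl; sym; trans; cong; cong₂; subst; subst₂; module ≡-Reasoning)
open import Relation.Binary.Definitions using (tri<; tri≈; tri>)
open import Relation.Nullary.Decidable using (recompute)
import Algebra.Structures as AS
open import Algebra.Bundles using (CommutativeSemigroup)
import Algebra.Properties.CommutativeSemigroup as CommSemigroupProperties
import Relation.Binary.Structures as RS
import Algebra.Solver.CommutativeMonoid as CommMonoidSolver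

module _ (ℝ : RealField) where
  open RealField ℝ
  open HMR ℝ
  open AS.IsCommutativeRing isCommutativeRing
    using ( +-identityˡ; +-identityʳ; -‿inverseˡ; -‿inverseʳ; +-assoc; +-comm
          ; *-comm; *-assoc; *-identityˡ; *-identityʳ; zeroʳ
          ; distribˡ; distribʳ; *-isCommutativeSemigroup )
  open RS.IsStrictTotalOrder isStrictTotalOrder
    using (compare; irrefl; asym; _<?_) renaming (trans to <-trans)

  *-commutativeSemigroup : CommutativeSemigroup _ _
  *-commutativeSemigroup = record { isCommutativeSemigroup = *-isCommutativeSemigroup }

  open CommSemigroupProperties *-commutativeSemigroup using (x∙yz≈y∙xz)
  open CommMonoidSolver (↭.++-commutativeMonoid {A = WTerm})
    using (solve; _⊜_) renaming (_⊕_ to _⊹_)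
  open ≡-Reasoning

  private variable
    t : Bool
    G H K : HSeq
    Γ Δ : Sequent

  0<x+y : ∀ {x y} → 0# < x → 0# < y → 0# < x + y
  0<x+y {x} {y} 0<x 0<y =
    <-trans 0<y (subst (_< x + y) (+-identityˡ y) (+-mono-< y 0<x))

  x<y⇒0<y-x : ∀ {x y} → x < y → 0# < y + - x
  x<y⇒0<y-x {x} {y} x<y = subst (_< y + - x) (-‿inverseʳ x) (+-mono-< (- x) x<y)

  *-monoˡ-< : ∀ {a x y} → 0# < a → x < y → a * x < a * y
  *-monoˡ-< {a} {x} {y} 0<a x<y =
    subst (_< a * y) (+-identityˡ (a * x))
      (subst (0# + a * x <_) a[y-x]+ax≡ay (+-mono-< (a * x) (*-pos 0<a (x<y⇒0<y-x x<y))))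
    where
    a[y-x]+ax≡ay : a * (y + - x) + a * x ≡ a * y
    a[y-x]+ax≡ay = begin
      a * (y + - x) + a * x ≡⟨ distribˡ a (y + - x) x ⟨
      a * ((y + - x) + x)   ≡⟨ cong (a *_) (+-assoc y (- x) x) ⟩
      a * (y + (- x + x))   ≡⟨ cong (λ z → a * (y + z)) (-‿inverseˡ x) ⟩
      a * (y + 0#)          ≡⟨ cong (a *_) (+-identityʳ y) ⟩
      a * y                 ∎

  *-monoˡ-≤ : ∀ {a x y} → 0# < a → x ≤ y → a * x ≤ a * y
  *-monoˡ-≤ 0<a (inj₁ x<y) = inj₁ (*-monoˡ-< 0<a x<y)
  *-monoˡ-≤ 0<a (inj₂ refl) = inj₂ refl

  x*y≡1⇒0<y : ∀ {x y} → 0# < x → x * y ≡ 1# → 0# < y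
  x*y≡1⇒0<y {x} {y} 0<x xy≡1 with compare 0# y
  ... | tri< 0<y _ _ = 0<y
  ... | tri≈ _ refl _ = ⊥-elim (irrefl (trans (sym (zeroʳ x)) xy≡1) 0<1)
  ... | tri> _ _ y<0 =
    ⊥-elim (asym 0<1 (subst₂ _<_ xy≡1 (zeroʳ x) (*-monoˡ-< 0<x y<0)))

  val>0 : (a : ℝ>0) → 0# < val a
  val>0 (pos a 0<a) = recompute (0# <? a) 0<a

  val-injective : ∀ {a b} → val a ≡ val b → a ≡ b
  val-injective {pos _ _} {pos _ _} refl = refl

  1⁺ : ℝ>0
  1⁺ = pos 1# 0<1

  _+⁺_ : ℝ>0 → ℝ>0 → ℝ>0
  a +⁺ b = pos (val a + val b) (0<x+y (val>0 a) (val>0 b))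

  val-invertible : ∀ a → ∃ λ y → val a * y ≡ 1#
  val-invertible a = *-inverse (val a) (λ a≡0 → irrefl (sym a≡0) (val>0 a))

  infix 30 _⁻¹
  _⁻¹ : ℝ>0 → ℝ>0
  a ⁻¹ = pos (proj₁ (val-invertible a)) (x*y≡1⇒0<y (val>0 a) (proj₂ (val-invertible a)))

  val-inverseʳ : ∀ a → val a * val (a ⁻¹) ≡ 1#
  val-inverseʳ a = proj₂ (val-invertible a)

  ·⁺-inverseˡ : ∀ a → a ⁻¹ ·⁺ a ≡ 1⁺
  ·⁺-inverseˡ a = val-injective (trans (*-comm (val (a ⁻¹)) (val a)) (val-inverseʳ a))

  ·⁺-identityˡ : ∀ a → 1⁺ ·⁺ a ≡ a
  ·⁺-identityˡ a = val-injective (*-identityˡ (val a))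

  ·⁺-comm : ∀ a b → a ·⁺ b ≡ b ·⁺ a
  ·⁺-comm a b = val-injective (*-comm (val a) (val b))

  ·⁺-assoc : ∀ a b c → (a ·⁺ b) ·⁺ c ≡ a ·⁺ (b ·⁺ c)
  ·⁺-assoc a b c = val-injective (*-assoc (val a) (val b) (val c))

  ·⁺-exchange : ∀ a b c → a ·⁺ (b ·⁺ c) ≡ b ·⁺ (a ·⁺ c)
  ·⁺-exchange a b c = val-injective (x∙yz≈y∙xz (val a) (val b) (val c))

  Σ⃗-map-·⁺ : ∀ a rs → Σ⃗ (map (a ·⁺_) rs) ≡ val a * Σ⃗ rs
  Σ⃗-map-·⁺ a []       = sym (zeroʳ (val a))
  Σ⃗-map-·⁺ a (r ∷ rs) = trans (cong (val a * val r +_) (Σ⃗-map-·⁺ a rs))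
                              (sym (distribˡ (val a) (val r) (Σ⃗ rs)))

  Σ⃗-map-·⁺-cong : ∀ a rs ss → Σ⃗ rs ≡ Σ⃗ ss → Σ⃗ (map (a ·⁺_) rs) ≡ Σ⃗ (map (a ·⁺_) ss)
  Σ⃗-map-·⁺-cong a rs ss eq =
    subst₂ _≡_ (sym (Σ⃗-map-·⁺ a rs)) (sym (Σ⃗-map-·⁺ a ss)) (cong (val a *_) eq)

  Σ⃗-map-·⁺-mono : ∀ a rs ss → Σ⃗ ss ≤ Σ⃗ rs → Σ⃗ (map (a ·⁺_) ss) ≤ Σ⃗ (map (a ·⁺_) rs)
  Σ⃗-map-·⁺-mono a rs ss le =
    subst₂ _≤_ (sym (Σ⃗-map-·⁺ a ss)) (sym (Σ⃗-map-·⁺ a rs)) (*-monoˡ-≤ (val>0 a) le)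

  scale-∙ : ∀ a rs A → scale a (rs ∙ A) ≡ map (a ·⁺_) rs ∙ A
  scale-∙ a rs A = trans (sym (map-∘ rs)) (map-∘ rs)

  scale-++ : ∀ a Γ Δ → scale a (Γ ++ Δ) ≡ scale a Γ ++ scale a Δ
  scale-++ a = map-++ _

  scale-++-∙ : ∀ a Γ rs A → scale a (Γ ++ rs ∙ A) ≡ scale a Γ ++ map (a ·⁺_) rs ∙ A
  scale-++-∙ a Γ rs A = trans (scale-++ a Γ (rs ∙ A)) (cong (scale a Γ ++_) (scale-∙ a rs A))

  scale-++-∙-∙ : ∀ a Γ rs A ss B →
    scale a (Γ ++ rs ∙ A ++ ss ∙ B) ≡ scale a Γ ++ map (a ·⁺_) rs ∙ A ++ map (a ·⁺_) ss ∙ B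
  scale-++-∙-∙ a Γ rs A ss B =
    trans (scale-++ a Γ (rs ∙ A ++ ss ∙ B))
          (cong (scale a Γ ++_) (trans (scale-++-∙ a (rs ∙ A) ss B)
                                       (cong (_++ _) (scale-∙ a rs A))))

  scale-◇S : ∀ a Γ → scale a (◇S Γ) ≡ ◇S (scale a Γ)
  scale-◇S a Γ = trans (sym (map-∘ Γ)) (map-∘ Γ)

  scale-scale : ∀ a b Γ → scale a (scale b Γ) ≡ scale (a ·⁺ b) Γ
  scale-scale a b [] = refl
  scale-scale a b ((r , A) ∷ Γ) =
    cong₂ _∷_ (cong (_, A) (sym (·⁺-assoc a b r))) (scale-scale a b Γ)

  scale-1⁺ : ∀ Γ → scale 1⁺ Γ ≡ Γ
  scale-1⁺ [] = refl
  scale-1⁺ ((r , A) ∷ Γ) = cong₂ _∷_ (cong (_, A) (·⁺-identityˡ r)) (scale-1⁺ Γ)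

  scale-inverse : ∀ a Γ → scale (a ⁻¹) (scale a Γ) ≡ Γ
  scale-inverse a Γ = begin
    scale (a ⁻¹) (scale a Γ) ≡⟨ scale-scale (a ⁻¹) a Γ ⟩
    scale (a ⁻¹ ·⁺ a) Γ      ≡⟨ cong (λ c → scale c Γ) (·⁺-inverseˡ a) ⟩
    scale 1⁺ Γ               ≡⟨ scale-1⁺ Γ ⟩
    Γ                        ∎

  map-·⁺-exchange : ∀ a b rs → map (a ·⁺_) (map (b ·⁺_) rs) ≡ map (b ·⁺_) (map (a ·⁺_) rs)
  map-·⁺-exchange a b rs =
    trans (sym (map-∘ rs)) (trans (map-cong (·⁺-exchange a b) rs) (map-∘ rs))

  exchange : Γ ↭ Δ → Deriv t (Γ ∷ G) → Deriv t (Δ ∷ G)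
  exchange Γ↭Δ = exch (_ , ↭-refl , Γ↭Δ ∷ Pointwise.refl ↭-refl)

  exchange-++ : ∀ Γ Δ → Deriv t ((Γ ++ Δ) ∷ G) → Deriv t ((Δ ++ Γ) ∷ G)
  exchange-++ Γ Δ = exchange (↭.++-comm Γ Δ)

  exchangeᴴ : G ↭ H → Deriv t G → Deriv t H
  exchangeᴴ G↭H = exch (_ , G↭H , Pointwise.refl ↭-refl)

  swapᴴ : Deriv t (Γ ∷ Δ ∷ G) → Deriv t (Δ ∷ Γ ∷ G)
  swapᴴ = exchangeᴴ (swap _ _ ↭-refl)

  weakenˡ : ∀ H → Deriv t G → Deriv t (H ++ G)
  weakenˡ []      d = d
  weakenˡ (Γ ∷ H) d = W (weakenˡ H d)

  weaken : ∀ H → Deriv t G → Deriv t (G ++ H)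
  weaken {G = G} H d = exchangeᴴ (↭.++-comm H G) (weakenˡ H d)

  cut : ∀ Δ₁ Δ₂ A rs → Deriv t ((Δ₁ ++ rs ∙ A) ∷ G) → Deriv t ((Δ₂ ++ rs ∙ neg A) ∷ G) →
        Deriv t ((Δ₁ ++ Δ₂) ∷ G)
  cut Δ₁ Δ₂ A rs d₁ d₂ = CAN A rs rs refl (exchange (medial Δ₁ (rs ∙ A) Δ₂ (rs ∙ neg A)) (M d₁ d₂))
    where
    medial : ∀ a b c d → (a ++ b) ++ (c ++ d) ↭ (a ++ c) ++ (b ++ d)
    medial = solve 4 (λ a b c d → (a ⊹ b) ⊹ (c ⊹ d) ⊜ (a ⊹ c) ⊹ (b ⊹ d)) ↭-refl

  DIA-without-units : Deriv t (Γ ∷ []) → Deriv t (◇S Γ ∷ [])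
  DIA-without-units {Γ = Γ} d =
    subst (λ Δ → Deriv _ (Δ ∷ [])) (++-identityʳ (◇S Γ))
      (DIA {Γ = Γ} [] [] (inj₂ refl) (subst (λ Δ → Deriv _ (Δ ∷ [])) (sym (++-identityʳ Γ)) d))

  ◇S-∙ : ∀ rs A → ◇S (rs ∙ A) ≡ rs ∙ ◇ A
  ◇S-∙ rs A = sym (map-∘ rs)

  ◇S-∙-++-∙ : ∀ rs A ss B → ◇S (rs ∙ A ++ ss ∙ B) ≡ rs ∙ ◇ A ++ ss ∙ ◇ B
  ◇S-∙-++-∙ rs A ss B = trans (map-++ _ (rs ∙ A) (ss ∙ B)) (cong₂ _++_ (◇S-∙ rs A) (◇S-∙ ss B))

  identity : ∀ A rs ss → Σ⃗ rs ≡ Σ⃗ ss → Deriv t ((rs ∙ A ++ ss ∙ neg A) ∷ [])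
  identity (var x) rs ss eq = ID x rs ss eq INIT
  identity (covar x) rs ss eq =
    exchange-++ (ss ∙ var x) (rs ∙ covar x) (ID x ss rs (sym eq) INIT)
  identity 𝟘 rs ss _ = Z ss (Z rs INIT)
  identity 𝟙 rs ss eq = ONE rs ss (inj₂ (sym eq)) INIT
  identity 𝟙̄ rs ss eq = exchange-++ (ss ∙ 𝟙) (rs ∙ 𝟙̄) (ONE ss rs (inj₂ eq) INIT)
  identity (A ⊕ B) rs ss eq =
    PLUS {Γ = rs ∙ (A ⊕ B)} ss (exchange-++ (ss ∙ neg A ++ ss ∙ neg B) (rs ∙ (A ⊕ B))
      (PLUS {Γ = ss ∙ neg A ++ ss ∙ neg B} rs
        (exchange (interleave (rs ∙ A) (ss ∙ neg A) (rs ∙ B) (ss ∙ neg B))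
          (M (identity A rs ss eq) (identity B rs ss eq)))))
    where
    interleave : ∀ a b c d → (a ++ b) ++ (c ++ d) ↭ (b ++ d) ++ (a ++ c)
    interleave = solve 4 (λ a b c d → (a ⊹ b) ⊹ (c ⊹ d) ⊜ (b ⊹ d) ⊹ (a ⊹ c)) ↭-refl
  identity (r ⊙ A) rs ss eq =
    TIMES {Γ = rs ∙ (r ⊙ A)} r ss (exchange-++ (map (r ·⁺_) ss ∙ neg A) (rs ∙ (r ⊙ A))
      (TIMES {Γ = map (r ·⁺_) ss ∙ neg A} r rs
        (exchange-++ (map (r ·⁺_) rs ∙ A) (map (r ·⁺_) ss ∙ neg A)
          (identity A (map (r ·⁺_) rs) (map (r ·⁺_) ss) (Σ⃗-map-·⁺-cong r rs ss eq)))))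
  identity (A ⊔ B) rs ss eq =
    INF {Γ = rs ∙ (A ⊔ B)} ss
      (exchange-++ (ss ∙ neg A) (rs ∙ (A ⊔ B)) (SUP {Γ = ss ∙ neg A} rs
        (weaken _ (exchange-++ (rs ∙ A) (ss ∙ neg A) (identity A rs ss eq)))))
      (exchange-++ (ss ∙ neg B) (rs ∙ (A ⊔ B)) (SUP {Γ = ss ∙ neg B} rs
        (W (exchange-++ (rs ∙ B) (ss ∙ neg B) (identity B rs ss eq)))))
  identity (A ⊓ B) rs ss eq =
    exchange-++ (ss ∙ (neg A ⊔ neg B)) (rs ∙ (A ⊓ B)) (INF {Γ = ss ∙ (neg A ⊔ neg B)} rs
      (exchange-++ (rs ∙ A) (ss ∙ (neg A ⊔ neg B)) (SUP {Γ = rs ∙ A} ss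
        (weaken _ (identity A rs ss eq))))
      (exchange-++ (rs ∙ B) (ss ∙ (neg A ⊔ neg B)) (SUP {Γ = rs ∙ B} ss
        (W (identity B rs ss eq)))))
  identity (◇ A) rs ss eq =
    subst (λ Δ → Deriv _ (Δ ∷ [])) (◇S-∙-++-∙ rs A ss (neg A)) (DIA-without-units (identity A rs ss eq))

  reweigh : ∀ Δ A {rs ss} → Σ⃗ rs ≡ Σ⃗ ss → Deriv t ((Δ ++ rs ∙ A) ∷ G) → Deriv t ((Δ ++ ss ∙ A) ∷ G)
  reweigh Δ A {rs} {ss} eq d = cut Δ (ss ∙ A) A rs d (weaken _ (identity A ss rs (sym eq)))

  ⊔-inversion : ∀ A B rs → Deriv t (rs ∙ (A ⊔ B) ∷ G) → Deriv t (rs ∙ A ∷ rs ∙ B ∷ G)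
  ⊔-inversion {G = G} A B rs d =
    cut [] (rs ∙ A) (A ⊔ B) rs (swapᴴ (W d))
      (swapᴴ (cut [] (rs ∙ B) (A ⊔ B) rs (swapᴴ (W d)) (weaken G ⊔-dual)))
    where
    crossed : ∀ a ā b b̄ → (a ++ ā) ++ (b ++ b̄) ↭ (a ++ b̄) ++ (b ++ ā)
    crossed = solve 4 (λ a ā b b̄ → (a ⊹ ā) ⊹ (b ⊹ b̄) ⊜ (a ⊹ b̄) ⊹ (b ⊹ ā)) ↭-refl

    A,B̄∣B,Ā : Deriv _ ((rs ∙ A ++ rs ∙ neg B) ∷ (rs ∙ B ++ rs ∙ neg A) ∷ [])
    A,B̄∣B,Ā = S (exchange (crossed (rs ∙ A) (rs ∙ neg A) (rs ∙ B) (rs ∙ neg B))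
                  (M (identity A rs rs refl) (identity B rs rs refl)))

    ⊔-dual : Deriv _ ((rs ∙ B ++ rs ∙ (neg A ⊓ neg B)) ∷ (rs ∙ A ++ rs ∙ (neg A ⊓ neg B)) ∷ [])
    ⊔-dual =
      INF {Γ = rs ∙ B} rs
        (swapᴴ (INF {Γ = rs ∙ A} rs (weaken _ (identity A rs rs refl)) A,B̄∣B,Ā))
        (weaken _ (identity B rs rs refl))

  ⟪_⟫ : Sequent → Term
  ⟪ [] ⟫          = 𝟘
  ⟪ (r , A) ∷ Γ ⟫ = (r ⊙ A) ⊕ ⟪ Γ ⟫

  swap-last : ∀ Δ (x y : WTerm) → (Δ ++ [ x ]) ++ [ y ] ↭ Δ ++ y ∷ x ∷ []
  swap-last Δ x y = ↭-trans (↭.++-assoc Δ [ x ] [ y ]) (↭.++⁺ˡ Δ (swap x y ↭-refl))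

  pack : ∀ Δ Γ w → Deriv t ((Δ ++ scale w Γ) ∷ G) → Deriv t ((Δ ++ [ w , ⟪ Γ ⟫ ]) ∷ G)
  pack Δ [] w d = Z {Γ = Δ} [ w ] (subst (λ Δ′ → Deriv _ (Δ′ ∷ _)) (++-identityʳ Δ) d)
  pack {t = t} {G = G} Δ ((r , A) ∷ Γ) w d =
    PLUS {Γ = Δ} [ w ] (exchange (swap-last Δ _ _) (TIMES {Γ = Δ ++ [ w , ⟪ Γ ⟫ ]} r [ w ]
      (exchange (↭.∷↭∷ʳ _ _)
        (subst (λ c → Deriv t (((c , A) ∷ Δ ++ [ w , ⟪ Γ ⟫ ]) ∷ G)) (·⁺-comm w r)
          (pack ((w ·⁺ r , A) ∷ Δ) Γ w (exchange (↭.shift _ Δ (scale w Γ)) d))))))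

  packed-identity : ∀ Γ w → Deriv t ((scale w Γ ++ [ w , neg ⟪ Γ ⟫ ]) ∷ [])
  packed-identity [] w = Z {Γ = []} [ w ] INIT
  packed-identity ((r , A) ∷ Γ) w =
    PLUS {Γ = (w ·⁺ r , A) ∷ scale w Γ} [ w ]
      (exchange (swap-last ((w ·⁺ r , A) ∷ scale w Γ) _ _)
        (TIMES {Γ = (w ·⁺ r , A) ∷ scale w Γ ++ [ w , neg ⟪ Γ ⟫ ]} r [ w ]
          (exchange (prep _ (↭.∷↭∷ʳ _ _))
            (M (identity A [ w ·⁺ r ] [ r ·⁺ w ] (cong (λ c → Σ⃗ [ c ]) (·⁺-comm w r)))
               (packed-identity Γ w)))))

  -- ab/(a+b): with c₁ = b/(a+b) and c₂ = a/(a+b) one has a c₁ = b c₂ = a ∥ b and c₁ + c₂ = 1.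
  infix 25 _∥_
  _∥_ : ℝ>0 → ℝ>0 → ℝ>0
  a ∥ b = a ·⁺ (b ·⁺ (a +⁺ b) ⁻¹)

  module _ (a b : ℝ>0) where
    private
      c₁ c₂ : ℝ>0
      c₁ = b ·⁺ (a +⁺ b) ⁻¹
      c₂ = a ·⁺ (a +⁺ b) ⁻¹

      cs : List ℝ>0
      cs = c₁ ∷ c₂ ∷ []

      Σ⃗cs≡1 : Σ⃗ cs ≡ 1#
      Σ⃗cs≡1 = begin
        val b * k + (val a * k + 0#) ≡⟨ cong (val b * k +_) (+-identityʳ (val a * k)) ⟩
        val b * k + val a * k        ≡⟨ distribʳ k (val b) (val a) ⟨
        (val b + val a) * k          ≡⟨ cong (_* k) (+-comm (val b) (val a)) ⟩
        (val a + val b) * k          ≡⟨ val-inverseʳ (a +⁺ b) ⟩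
        1#                           ∎
        where k = val ((a +⁺ b) ⁻¹)

      b·c₂≡a∥b : b ·⁺ c₂ ≡ a ∥ b
      b·c₂≡a∥b = ·⁺-exchange b a ((a +⁺ b) ⁻¹)

    split-scaled : ∀ Γ₁ Γ₂ → Deriv t (scale (a ∥ b) (Γ₁ ++ Γ₂) ∷ G) →
                   Deriv t (scale a Γ₁ ∷ scale b Γ₂ ∷ G)
    split-scaled {G = G} Γ₁ Γ₂ d =
      swapᴴ (cut [] (scale b Γ₂) (b ⊙ Y) cs
              (swapᴴ (cut [] (scale a Γ₁) (a ⊙ X) cs aX∣bY (weaken _ (unpacked a Γ₁))))
              (weaken _ (unpacked b Γ₂)))
      where
      X Y : Term
      X = ⟪ Γ₁ ⟫
      Y = ⟪ Γ₂ ⟫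
      μ : ℝ>0
      μ = a ∥ b

      packed : Deriv _ (((μ , Y) ∷ (μ , X) ∷ []) ∷ G)
      packed =
        pack [ μ , Y ] Γ₁ μ (exchange-++ (scale μ Γ₁) [ μ , Y ]
          (pack (scale μ Γ₁) Γ₂ μ (subst (λ Δ → Deriv _ (Δ ∷ G)) (scale-++ μ Γ₁ Γ₂) d)))

      aX⊔bY : Term
      aX⊔bY = (a ⊙ X) ⊔ (b ⊙ Y)

      aX⊔bY,X̄ : Deriv _ (((c₁ , aX⊔bY) ∷ (μ , neg X) ∷ []) ∷ [])
      aX⊔bY,X̄ =
        exchange-++ [ μ , neg X ] [ c₁ , aX⊔bY ] (SUP {Γ = [ μ , neg X ]} [ c₁ ]
          (weaken _ (TIMES {Γ = [ μ , neg X ]} a [ c₁ ]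
            (exchange-++ [ μ , X ] [ μ , neg X ] (identity X [ μ ] [ μ ] refl)))))

      aX⊔bY,Ȳ : Deriv _ (((c₂ , aX⊔bY) ∷ (μ , neg Y) ∷ []) ∷ [])
      aX⊔bY,Ȳ =
        exchange-++ [ μ , neg Y ] [ c₂ , aX⊔bY ] (SUP {Γ = [ μ , neg Y ]} [ c₂ ]
          (W (TIMES {Γ = [ μ , neg Y ]} b [ c₂ ]
            (exchange-++ [ b ·⁺ c₂ , Y ] [ μ , neg Y ]
              (identity Y [ b ·⁺ c₂ ] [ μ ] (cong (λ c → Σ⃗ [ c ]) b·c₂≡a∥b))))))

      aX⊔bY-twice : Deriv _ (cs ∙ aX⊔bY ∷ G)
      aX⊔bY-twice =
        cut [ c₁ , aX⊔bY ] [ c₂ , aX⊔bY ] Y [ μ ]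
          (exchange-++ [ μ , Y ] [ c₁ , aX⊔bY ]
            (cut [ μ , Y ] [ c₁ , aX⊔bY ] X [ μ ] packed (weaken G aX⊔bY,X̄)))
          (weaken G aX⊔bY,Ȳ)

      aX∣bY : Deriv _ (cs ∙ (a ⊙ X) ∷ cs ∙ (b ⊙ Y) ∷ G)
      aX∣bY = ⊔-inversion (a ⊙ X) (b ⊙ Y) cs aX⊔bY-twice

      unpacked : ∀ u Γ → Deriv _ ((scale u Γ ++ cs ∙ (u ⊙ neg ⟪ Γ ⟫)) ∷ [])
      unpacked u Γ =
        TIMES {Γ = scale u Γ} u cs (reweigh (scale u Γ) (neg ⟪ Γ ⟫) Σ⃗[u]≡Σ⃗u·cs (packed-identity Γ u))
        where
        Σ⃗[u]≡Σ⃗u·cs : Σ⃗ [ u ] ≡ Σ⃗ (map (u ·⁺_) cs)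
        Σ⃗[u]≡Σ⃗u·cs = begin
          val u + 0#               ≡⟨ +-identityʳ (val u) ⟩
          val u                    ≡⟨ *-identityʳ (val u) ⟨
          val u * 1#               ≡⟨ cong (val u *_) Σ⃗cs≡1 ⟨
          val u * Σ⃗ cs             ≡⟨ Σ⃗-map-·⁺ u cs ⟨
          Σ⃗ (map (u ·⁺_) cs)       ∎

  Rescaling : HSeq → HSeq → Set
  Rescaling = Pointwise (λ Γ Δ → ∃ λ a → scale a Γ ≡ Δ)

  Rescaling-pointwise-↭ : Pointwise _≈S_ G H → Rescaling H K →
                          ∃ λ G′ → Rescaling G G′ × Pointwise _≈S_ G′ K
  Rescaling-pointwise-↭ [] [] = [] , [] , []
  Rescaling-pointwise-↭ (Γ↭Δ ∷ G≋H) ((a , refl) ∷ H≤K) with Rescaling-pointwise-↭ G≋H H≤K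
  ... | G′ , G≤G′ , G′≋K = scale a _ ∷ G′ , (a , refl) ∷ G≤G′ , ↭.map⁺ _ Γ↭Δ ∷ G′≋K

  Rescaling-↭ : G ↭ H → Rescaling H K → ∃ λ G′ → Rescaling G G′ × G′ ↭ K
  Rescaling-↭ ↭-refl H≤K = _ , H≤K , ↭-refl
  Rescaling-↭ (prep Γ G↭H) (e ∷ H≤K) with Rescaling-↭ G↭H H≤K
  ... | _ , G≤G′ , G′↭K = _ , e ∷ G≤G′ , prep _ G′↭K
  Rescaling-↭ (swap Γ Δ G↭H) (e ∷ e′ ∷ H≤K) with Rescaling-↭ G↭H H≤K
  ... | _ , G≤G′ , G′↭K = _ , e′ ∷ e ∷ G≤G′ , swap _ _ G′↭K
  Rescaling-↭ (↭-trans G↭H H↭H′) H′≤K with Rescaling-↭ H↭H′ H′≤K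
  ... | _ , H≤K′ , K′↭K with Rescaling-↭ G↭H H≤K′
  ... | _ , G≤G′ , G′↭K′ = _ , G≤G′ , ↭-trans G′↭K′ K′↭K

  rescale : Deriv false G → Rescaling G H → Deriv false H
  rescale INIT ((a , refl) ∷ []) = INIT
  rescale (exch (G′ , G↭G′ , G′≋H) d) H≤K with Rescaling-pointwise-↭ G′≋H H≤K
  ... | K′ , G′≤K′ , K′≋K with Rescaling-↭ G↭G′ G′≤K′
  ... | K″ , G≤K″ , K″↭K′ = exch (K′ , K″↭K′ , K′≋K) (rescale d G≤K″)
  rescale (W d) (_ ∷ G≤H) = W (rescale d G≤H)
  rescale (C d) (e ∷ G≤H) = C (rescale d (e ∷ e ∷ G≤H))
  rescale (S {Γ₁ = Γ₁} {Γ₂} d) ((a , refl) ∷ (b , refl) ∷ G≤H) =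
    split-scaled a b Γ₁ Γ₂ (rescale d ((a ∥ b , refl) ∷ G≤H))
  rescale (M {Γ₁ = Γ₁} {Γ₂} d₁ d₂) ((a , refl) ∷ G≤H) rewrite scale-++ a Γ₁ Γ₂ =
    M (rescale d₁ ((a , refl) ∷ G≤H)) (rescale d₂ ((a , refl) ∷ G≤H))
  rescale (T () _ _) _
  rescale (ID {Γ = Γ} x rs ss eq d) ((a , refl) ∷ G≤H)
    rewrite scale-++-∙-∙ a Γ rs (var x) ss (covar x) =
    ID x (map (a ·⁺_) rs) (map (a ·⁺_) ss) (Σ⃗-map-·⁺-cong a rs ss eq) (rescale d ((a , refl) ∷ G≤H))
  rescale (Z {Γ = Γ} rs d) ((a , refl) ∷ G≤H) rewrite scale-++-∙ a Γ rs 𝟘 =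
    Z (map (a ·⁺_) rs) (rescale d ((a , refl) ∷ G≤H))
  rescale (PLUS {Γ = Γ} {A} {B} rs d) ((a , refl) ∷ G≤H) rewrite scale-++-∙ a Γ rs (A ⊕ B) =
    PLUS (map (a ·⁺_) rs) (rescale d ((a , scale-++-∙-∙ a Γ rs A rs B) ∷ G≤H))
  rescale (TIMES {Γ = Γ} {A} s rs d) ((a , refl) ∷ G≤H) rewrite scale-++-∙ a Γ rs (s ⊙ A) =
    TIMES s (map (a ·⁺_) rs) (rescale d ((a , scaled-premise) ∷ G≤H))
    where
    scaled-premise : scale a (Γ ++ map (s ·⁺_) rs ∙ A) ≡ scale a Γ ++ map (s ·⁺_) (map (a ·⁺_) rs) ∙ A
    scaled-premise = trans (scale-++-∙ a Γ (map (s ·⁺_) rs) A)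
                           (cong (λ qs → scale a Γ ++ qs ∙ A) (map-·⁺-exchange a s rs))
  rescale (SUP {Γ = Γ} {A} {B} rs d) ((a , refl) ∷ G≤H) rewrite scale-++-∙ a Γ rs (A ⊔ B) =
    SUP (map (a ·⁺_) rs) (rescale d ((a , scale-++-∙ a Γ rs A) ∷ (a , scale-++-∙ a Γ rs B) ∷ G≤H))
  rescale (INF {Γ = Γ} {A} {B} rs d₁ d₂) ((a , refl) ∷ G≤H) rewrite scale-++-∙ a Γ rs (A ⊓ B) =
    INF (map (a ·⁺_) rs) (rescale d₁ ((a , scale-++-∙ a Γ rs A) ∷ G≤H))
                         (rescale d₂ ((a , scale-++-∙ a Γ rs B) ∷ G≤H))
  rescale (CAN {Γ = Γ} A rs ss eq d) ((a , refl) ∷ G≤H) =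
    CAN A (map (a ·⁺_) rs) (map (a ·⁺_) ss) (Σ⃗-map-·⁺-cong a rs ss eq)
      (rescale d ((a , scale-++-∙-∙ a Γ ss A rs (neg A)) ∷ G≤H))
  rescale (ONE {Γ = Γ} rs ss le d) ((a , refl) ∷ G≤H) rewrite scale-++-∙-∙ a Γ rs 𝟙 ss 𝟙̄ =
    ONE (map (a ·⁺_) rs) (map (a ·⁺_) ss) (Σ⃗-map-·⁺-mono a rs ss le) (rescale d ((a , refl) ∷ G≤H))
  rescale (DIA {Γ = Γ} rs ss le d) ((a , refl) ∷ [])
    rewrite scale-++-∙-∙ a (◇S Γ) rs 𝟙 ss 𝟙̄ | scale-◇S a Γ =
    DIA {Γ = scale a Γ} (map (a ·⁺_) rs) (map (a ·⁺_) ss) (Σ⃗-map-·⁺-mono a rs ss le)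
      (rescale d ((a , scale-++-∙-∙ a Γ rs 𝟙 ss 𝟙̄) ∷ []))

  eliminate-T : Deriv true G → Deriv false G
  eliminate-T INIT                 = INIT
  eliminate-T (exch G≈H d)         = exch G≈H (eliminate-T d)
  eliminate-T (W d)                = W (eliminate-T d)
  eliminate-T (C d)                = C (eliminate-T d)
  eliminate-T (S d)                = S (eliminate-T d)
  eliminate-T (M d₁ d₂)            = M (eliminate-T d₁) (eliminate-T d₂)
  eliminate-T (T {Γ = Γ} _ r d)    =
    rescale (eliminate-T d) ((r ⁻¹ , scale-inverse r Γ) ∷ Pointwise.refl (1⁺ , scale-1⁺ _))
  eliminate-T (ID x rs ss eq d)    = ID x rs ss eq (eliminate-T d)
  eliminate-T (Z rs d)             = Z rs (eliminate-T d)
  eliminate-T (PLUS rs d)          = PLUS rs (eliminate-T d)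
  eliminate-T (TIMES s rs d)       = TIMES s rs (eliminate-T d)
  eliminate-T (SUP rs d)           = SUP rs (eliminate-T d)
  eliminate-T (INF rs d₁ d₂)       = INF rs (eliminate-T d₁) (eliminate-T d₂)
  eliminate-T (CAN A rs ss eq d)   = CAN A rs ss eq (eliminate-T d)
  eliminate-T (ONE rs ss le d)     = ONE rs ss le (eliminate-T d)
  eliminate-T (DIA {Γ = Γ} rs ss le d) = DIA {Γ = Γ} rs ss le (eliminate-T d)

corollary4p24 : (ℝ : RealField) → let open HMR ℝ in
    (G : HSeq) → Derivable G → DerivableWithoutT G
corollary4p24 ℝ G = eliminate-T ℝ
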